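{- Let $T$ be the reading order filling of $[\Lambda]$. For every injective $w:[n]\to[K]$ admissible with respect to $T$, we have $\mathrm{inv}_T(w)=\mathrm{dinv}(\mathrm{PRD}_T(w))$.
   Context: Setup: $n\ge0$, $\lambda$ a partition of $k\le n$, $s\ge\ell(\lambda)$, $\lambda_i=0$ for $i>\ell(\lambda)$, $\Lambda=(\lambda_1+n-k,\dots,\lambda_s+n-k)$, $K=k+(n-k)s$, $[m]=\{1,\dots,m\}$, $[\Lambda]=\{(i,j):1\le i\le s,1\le j\le\Lambda_i\}$ (row $i$ from the top, column $j$ from the left). The reading order of $[\Lambda]$ lists the cells by reading down each column (top to bottom), taking the columns from right to left; the reading order filling is the bijection $T:[\Lambda]\to[K]$ with $T(i,j)=\ell$ iff $(i,j)$ is the $\ell$th cell in reading order. An injective $w:[n]\to[K]$ is admissible with respect to $T$ if its image contains $[k]$ and whenever $T(a,b)=w(i)$, either $b=\Lambda_a$ or $T(a,b+1)=w(i')$ for some $i'<i$. $\mathrm{PRD}_T(w)$ is the partial filling of $[\Lambda]$ in which cell $(a,b)$ is labeled $i$ if $w(i)=T(a,b)$ and is empty otherwise. An inversion of $w$ with respect to $T$ is a pair $(c,i)$ with $1\le c\le n$, $1\le i\le s$ such that either (IT1) some cell of row $i$ of $\mathrm{PRD}_T(w)$ carries a label $\ell>c$ with $w(\ell)<w(c)$, or (IT2) (IT1) fails and some empty cell $(i,j)$ in row $i$ has $T(i,j)<w(c)$; $\mathrm{inv}_T(w)$ is their number. For a partial filling $\varphi$ of $[\Lambda]$ with label $\varphi_{i,j}$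 in cell $(i,j)$, an attacking pair is a pair of cells $((i,j),(p,q))$ of $[\Lambda]$ with either $j=q$ and $i<p$, or $j=q+1$ and $i>p$. A diagonal inversion of $\varphi$ is an attacking pair $((i,j),(p,q))$ such that either (D1) both cells are filled and $\varphi_{i,j}>\varphi_{p,q}$, or (D2) $(i,j)$ is empty and $(p,q)$ is filled. $\mathrm{dinv}(\varphi)$ is the number of diagonal inversions. -}

module Defs where

open import Data.Nat using (ℕ; zero; suc; _+_; _*_; _∸_; _≤_; _<_; _≡ᵇ_; _<ᵇ_)
open import Data.Bool using (Bool; true; false; _∧_; _∨_; not; if_then_else_)
open import Data.List using (List; []; _∷_; map; concatMap; upTo; sum; length)
open import Data.List.Relation.Unary.All using (All)
open import Data.List.Relation.Unary.Linked using (Linked)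
open import Data.Maybe using (Maybe; just; nothing)
open import Data.Product using (_×_; _,_)

range1 : ℕ → List ℕ
range1 m = map suc (upTo m)

count : {A : Set} → (A → Bool) → List A → ℕ
count p []       = 0
count p (x ∷ xs) = if p x then suc (count p xs) else count p xs

anyᵇ : {A : Set} → (A → Bool) → List A → Bool
anyᵇ p []       = false
anyᵇ p (x ∷ xs) = p x ∨ anyᵇ p xs

_≤ᵇ_ : ℕ → ℕ → Bool
a ≤ᵇ b = a <ᵇ suc b

IsPartition : List ℕ → Set
IsPartition lam = All (λ x → 0 < x) lam × Linked (λ x y → y ≤ x) lam

-- λ_i (1-indexed), 0 beyond the length
part : List ℕ → ℕ → ℕ
part []       _             = 0
part (x ∷ xs) zero          = 0
part (x ∷ xs) (suc zero)    = x
part (x ∷ xs) (suc (suc i)) = part xs (suc i)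

bigΛ : List ℕ → ℕ → ℕ → ℕ → ℕ
bigΛ lam n k i = part lam i + (n ∸ k)

-- The shape [Λ] is given by s (number of rows) and a row-length function Λ.
-- cells of [Λ], (row, column), 1-indexed
cells : ℕ → (ℕ → ℕ) → List (ℕ × ℕ)
cells s Λ = concatMap (λ a → map (λ b → (a , b)) (range1 (Λ a))) (range1 s)

inShape : ℕ → (ℕ → ℕ) → ℕ → ℕ → Bool
inShape s Λ a b = (1 ≤ᵇ a) ∧ (a ≤ᵇ s) ∧ (1 ≤ᵇ b) ∧ (b ≤ᵇ Λ a)

-- reading order: down each column, columns right to left.
-- (p,q) comes no later than (a,b) iff q > b, or q = b and p ≤ a.
-- T(a,b) = position of (a,b) in reading order.
readingT : ℕ → (ℕ → ℕ) → ℕ → ℕ → ℕ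
readingT s Λ a b =
  count (λ { (p , q) → (b <ᵇ q) ∨ ((q ≡ᵇ b) ∧ (p ≤ᵇ a)) }) (cells s Λ)

preimage : ℕ → (ℕ → ℕ) → ℕ → Maybe ℕ
preimage n w t = go (range1 n)
  where
  go : List ℕ → Maybe ℕ
  go []       = nothing
  go (i ∷ is) = if w i ≡ᵇ t then just i else go is

-- a partial filling of [Λ]: a label (or nothing = empty) for each cell
PartialFilling : Set
PartialFilling = ℕ → ℕ → Maybe ℕ

PRD : ℕ → (ℕ → ℕ) → (ℕ → ℕ → ℕ) → ℕ → (ℕ → ℕ) → PartialFilling
PRD s Λ T n w a b = if inShape s Λ a b then preimage n w (T a b) else nothing

IsInjectiveMap : ℕ → ℕ → (ℕ → ℕ) → Set
IsInjectiveMap n K w =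
  (∀ i → 1 ≤ i → i ≤ n → 1 ≤ w i × w i ≤ K) ×
  (∀ i j → 1 ≤ i → i ≤ n → 1 ≤ j → j ≤ n → w i ≡ w j → i ≡ j)
  where open import Relation.Binary.PropositionalEquality using (_≡_)

open import Relation.Binary.PropositionalEquality using (_≡_)
open import Data.Sum using (_⊎_)
open import Data.Product using (Σ; ∃)

Admissible : ℕ → (ℕ → ℕ) → (ℕ → ℕ → ℕ) → ℕ → ℕ → (ℕ → ℕ) → Set
Admissible s Λ T n k w =
  (∀ m → 1 ≤ m → m ≤ k → Σ ℕ (λ i → 1 ≤ i × i ≤ n × w i ≡ m)) ×
  (∀ i a b → 1 ≤ i → i ≤ n → 1 ≤ a → a ≤ s → 1 ≤ b → b ≤ Λ a → T a b ≡ w i →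
     (b ≡ Λ a) ⊎ Σ ℕ (λ i' → 1 ≤ i' × i' < i × T a (suc b) ≡ w i'))

IT1 : ℕ → (ℕ → ℕ) → (ℕ → ℕ → ℕ) → ℕ → (ℕ → ℕ) → ℕ → ℕ → Bool
IT1 s Λ T n w c i = anyᵇ f (range1 (Λ i))
  where
  f : ℕ → Bool
  f j with PRD s Λ T n w i j
  ... | just l  = (c <ᵇ l) ∧ (w l <ᵇ w c)
  ... | nothing = false

IT2 : ℕ → (ℕ → ℕ) → (ℕ → ℕ → ℕ) → ℕ → (ℕ → ℕ) → ℕ → ℕ → Bool
IT2 s Λ T n w c i = anyᵇ f (range1 (Λ i))
  where
  f : ℕ → Bool
  f j with PRD s Λ T n w i j
  ... | just l  = false
  ... | nothing = T i j <ᵇ w c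

inv : ℕ → (ℕ → ℕ) → (ℕ → ℕ → ℕ) → ℕ → (ℕ → ℕ) → ℕ
inv s Λ T n w =
  count (λ { (c , i) → IT1 s Λ T n w c i ∨ (not (IT1 s Λ T n w c i) ∧ IT2 s Λ T n w c i) })
        (concatMap (λ c → map (λ i → (c , i)) (range1 s)) (range1 n))

attacking : (ℕ × ℕ) → (ℕ × ℕ) → Bool
attacking (i , j) (p , q) = ((j ≡ᵇ q) ∧ (i <ᵇ p)) ∨ ((j ≡ᵇ suc q) ∧ (p <ᵇ i))

diagInv : PartialFilling → (ℕ × ℕ) → (ℕ × ℕ) → Bool
diagInv φ (i , j) (p , q) with φ i j | φ p q
... | just x  | just y  = y <ᵇ x
... | nothing | just y  = true
... | _       | nothing = false

dinv : ℕ → (ℕ → ℕ) → PartialFilling → ℕ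
dinv s Λ φ =
  count (λ { (x , y) → attacking x y ∧ diagInv φ x y })
        (concatMap (λ x → map (λ y → (x , y)) (cells s Λ)) (cells s Λ))

{-# OPTIONS --safe #-}

-- Both statistics are sums over the labels c of w. An inversion (c, i) is witnessed by a cell of
-- row i read before w(c) that is empty or holds a label larger than c; these cells are the ones in
-- columns ≥ m for some m. Admissibility makes the filled cells of a row a final segment whose
-- labels decrease to the right, so the witness may be taken to be the cell (i, m) itself. If c
-- sits in (p, q), then m = q for i < p and m = q + 1 for i ≥ p: for i ≠ p these are exactly the
-- cells attacking (p, q), and (D1)/(D2) are the two kinds of witness, while for i = p the cell
-- (p, q + 1), if present, holds a smaller label. So the diagonal inversions whose second cell holds
-- c are the inversions (c, i); as the reading-order filling is a bijection onto [K], summing over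
-- c gives inv = dinv.

module Submission where

open import Defs
open import Data.Nat using (ℕ; _+_; _*_; _∸_; _≤_)
open import Data.List using (List; length)
open import Data.Nat.ListAction using (sum)
open import Relation.Binary.PropositionalEquality using (_≡_)

open import Data.Bool using (Bool; true; false; _∧_; _∨_; not; if_then_else_) renaming (T to True)
open import Data.Bool.Properties using (T-∨; T-∧; T-≡; ∧-zeroʳ; ∧-identityʳ; ∨-identityʳ)
open import Data.Empty using (⊥-elim)
open import Data.List using ([]; _∷_; _++_; map; concatMap; upTo; applyUpTo)
open import Data.List.Membership.Propositional using (_∈_; _∉_)
open import Data.List.Membership.Propositional.Properties
  using (∈-map⁺; ∈-map⁻; ∈-upTo⁺; ∈-upTo⁻; ∈-++⁺ˡ; ∈-++⁺ʳ; ∈-++⁻)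
open import Data.List.Properties using (length-map; length-upTo; map-applyUpTo)
open import Data.List.Relation.Unary.All using (lookup)
open import Data.List.Relation.Unary.Any using (here; there)
open import Data.List.Relation.Unary.Linked using (Linked; [-]; _∷_; tail)
open import Data.List.Relation.Unary.Unique.Propositional using (Unique; []; _∷_)
open import Data.List.Relation.Unary.Unique.Propositional.Properties using (map⁺; upTo⁺; ++⁺)
open import Data.Maybe using (Maybe; just; nothing; maybe′)
open import Data.Nat using (zero; suc; _<_; _≡ᵇ_; _<ᵇ_; z≤n; s≤s)
open import Data.Nat.Properties
open import Algebra.Properties.CommutativeSemigroup +-commutativeSemigroup using (interchange)
open import Data.Product using (_×_; _,_; proj₁; proj₂; ∃)
open import Data.Sum using (_⊎_; inj₁; inj₂; [_,_]′)
open import Function using (_∘_; id; _⟨_⟩_; case_of_; _⇔_; mk⇔; Equivalence)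
open import Function.Construct.Composition using (_⇔-∘_)
open import Relation.Nullary using (¬_; yes; no)
open import Relation.Nullary.Decidable using (T?)
open import Relation.Binary using (tri<; tri≈; tri>)
open import Relation.Binary.PropositionalEquality
  using (_≢_; refl; sym; trans; cong; cong₂; subst; subst₂; module ≡-Reasoning)

open Equivalence using (to; from)

private
  variable
    A B : Set
    xs : List A
    f g : A → ℕ
    p q : A → Bool
    y : A

𝟙 : Bool → ℕ
𝟙 true  = 1
𝟙 false = 0

𝟙-true : ∀ {b} → True b → 𝟙 b ≡ 1
𝟙-true {true} _ = refl

𝟙-false : ∀ {b} → ¬ True b → 𝟙 b ≡ 0
𝟙-false {true}  ¬b = ⊥-elim (¬b _)
𝟙-false {false} _  = refl

𝟙-≤1 : ∀ b → 𝟙 b ≤ 1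
𝟙-≤1 true  = ≤-refl
𝟙-≤1 false = z≤n

𝟙-mono : ∀ {b c} → (True b → True c) → 𝟙 b ≤ 𝟙 c
𝟙-mono {true}  b⇒c rewrite 𝟙-true (b⇒c _) = ≤-refl
𝟙-mono {false} _   = z≤n

¬True⇒≡false : ∀ {b} → ¬ True b → b ≡ false
¬True⇒≡false {true}  ¬b = ⊥-elim (¬b _)
¬True⇒≡false {false} _  = refl

True-⇔⇒≡ : ∀ {b c} → True b ⇔ True c → b ≡ c
True-⇔⇒≡ {true}  {true}  _   = refl
True-⇔⇒≡ {true}  {false} b⇔c = ⊥-elim (to b⇔c _)
True-⇔⇒≡ {false} {true}  b⇔c = ⊥-elim (from b⇔c _)
True-⇔⇒≡ {false} {false} _   = refl

True-or-else : ∀ a b → True (a ∨ (not a ∧ b)) ⇔ (True a ⊎ True b)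
True-or-else true  b = mk⇔ inj₁ (λ _ → _)
True-or-else false b = mk⇔ inj₂ [ (λ ()) , id ]′

≢⇒≡ᵇ-false : ∀ m n → m ≢ n → (m ≡ᵇ n) ≡ false
≢⇒≡ᵇ-false m n m≢n = ¬True⇒≡false (m≢n ∘ ≡ᵇ⇒≡ m n)

≮⇒<ᵇ-false : ∀ m n → ¬ m < n → (m <ᵇ n) ≡ false
≮⇒<ᵇ-false m n m≮n = ¬True⇒≡false (m≮n ∘ <ᵇ⇒< m n)

-- `Defs._≤ᵇ_` is `m <ᵇ suc n`, not the library's `_≤ᵇ_`.
≤ᵇ⇒≤′ : ∀ m n → True (m ≤ᵇ n) → m ≤ n
≤ᵇ⇒≤′ m n m≤n = ≤-pred (<ᵇ⇒< m (suc n) m≤n)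

≤⇒≤ᵇ′ : ∀ {m n} → m ≤ n → True (m ≤ᵇ n)
≤⇒≤ᵇ′ m≤n = <⇒<ᵇ (s≤s m≤n)

anyᵇ-cong : ∀ {f g : A → Bool} xs → (∀ x → f x ≡ g x) → anyᵇ f xs ≡ anyᵇ g xs
anyᵇ-cong []       _   = refl
anyᵇ-cong (x ∷ xs) f≡g = cong₂ _∨_ (f≡g x) (anyᵇ-cong xs f≡g)

anyᵇ⇒∃ : ∀ {f : A → Bool} xs → True (anyᵇ f xs) → ∃ λ x → x ∈ xs × True (f x)
anyᵇ⇒∃ {f = f} (x ∷ xs) any with to (T-∨ {f x}) any
... | inj₁ fx  = x , here refl , fx
... | inj₂ any′ with anyᵇ⇒∃ xs any′
...   | y , y∈ , fy = y , there y∈ , fy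

∃⇒anyᵇ : ∀ {f : A → Bool} {x xs} → x ∈ xs → True (f x) → True (anyᵇ f xs)
∃⇒anyᵇ {f = f} {xs = y ∷ _} (here refl) fx = from (T-∨ {f y}) (inj₁ fx)
∃⇒anyᵇ {f = f} {xs = y ∷ _} (there x∈) fx = from (T-∨ {f y}) (inj₂ (∃⇒anyᵇ x∈ fx))

if-then-nothing : ∀ b {m : Maybe A} {x} → (if b then m else nothing) ≡ just x → True b × m ≡ just x
if-then-nothing true found = _ , found

True-maybe-just : ∀ {F : ℕ → Bool} μ → True (maybe′ F false μ) → ∃ λ l → μ ≡ just l × True (F l)
True-maybe-just (just l) Fl = l , refl , Fl

True-maybe-nothing : ∀ {b} (μ : Maybe ℕ) → True (maybe′ (λ _ → false) b μ) → μ ≡ nothing × True b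
True-maybe-nothing nothing b = refl , b

-- Finite sums

∑ : List A → (A → ℕ) → ℕ
∑ []       f = 0
∑ (x ∷ xs) f = f x + ∑ xs f

syntax ∑ xs (λ x → e) = ∑[ x ∈ xs ] e

count≡∑ : (p : A → Bool) (xs : List A) → count p xs ≡ ∑[ x ∈ xs ] 𝟙 (p x)
count≡∑ p []       = refl
count≡∑ p (x ∷ xs) with p x
... | true  = cong suc (count≡∑ p xs)
... | false = count≡∑ p xs

∑-++ : ∀ (xs ys : List A) f → ∑ (xs ++ ys) f ≡ ∑ xs f + ∑ ys f
∑-++ []       ys f = refl
∑-++ (x ∷ xs) ys f = trans (cong (f x +_) (∑-++ xs ys f)) (sym (+-assoc (f x) _ _))

∑-map : ∀ (h : A → B) xs (f : B → ℕ) → ∑ (map h xs) f ≡ ∑[ x ∈ xs ] f (h x)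
∑-map h []       f = refl
∑-map h (x ∷ xs) f = cong (f (h x) +_) (∑-map h xs f)

∑-cong : (∀ {x} → x ∈ xs → f x ≡ g x) → ∑ xs f ≡ ∑ xs g
∑-cong {xs = []}     _  = refl
∑-cong {xs = x ∷ xs} f≡g = cong₂ _+_ (f≡g (here refl)) (∑-cong (f≡g ∘ there))

∑-zero : (∀ {x} → x ∈ xs → f x ≡ 0) → ∑ xs f ≡ 0
∑-zero {xs = []}     _  = refl
∑-zero {xs = x ∷ xs} f≡0 = cong₂ _+_ (f≡0 (here refl)) (∑-zero (f≡0 ∘ there))

∑-1 : ∀ (xs : List A) → ∑[ x ∈ xs ] 1 ≡ length xs
∑-1 []       = refl
∑-1 (x ∷ xs) = cong suc (∑-1 xs)

∑-const : ∀ (xs : List A) c → ∑[ _ ∈ xs ] c ≡ length xs * c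
∑-const []       c = refl
∑-const (x ∷ xs) c = cong (c +_) (∑-const xs c)

∑-+ : ∀ (xs : List A) f g → ∑[ x ∈ xs ] (f x + g x) ≡ ∑ xs f + ∑ xs g
∑-+ []       f g = refl
∑-+ (x ∷ xs) f g = trans (cong (f x + g x +_) (∑-+ xs f g)) (interchange (f x) (g x) _ _)

∑-*ʳ : ∀ (xs : List A) f c → ∑[ x ∈ xs ] (f x * c) ≡ ∑ xs f * c
∑-*ʳ []       f c = refl
∑-*ʳ (x ∷ xs) f c = trans (cong (f x * c +_) (∑-*ʳ xs f c)) (sym (*-distribʳ-+ c (f x) _))

∑-swap : ∀ (xs : List A) (ys : List B) (f : A → B → ℕ) →
         ∑[ x ∈ xs ] ∑[ y ∈ ys ] f x y ≡ ∑[ y ∈ ys ] ∑[ x ∈ xs ] f x y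
∑-swap []       ys f = sym (∑-zero {xs = ys} (λ _ → refl))
∑-swap (x ∷ xs) ys f =
  trans (cong (∑ ys (f x) +_) (∑-swap xs ys f)) (sym (∑-+ ys (f x) _))

∑-mono-≤ : (∀ {x} → x ∈ xs → f x ≤ g x) → ∑ xs f ≤ ∑ xs g
∑-mono-≤ {xs = []}     _   = z≤n
∑-mono-≤ {xs = x ∷ xs} f≤g = +-mono-≤ (f≤g (here refl)) (∑-mono-≤ (f≤g ∘ there))

∑-mono-< : (∀ {x} → x ∈ xs → f x ≤ g x) → y ∈ xs → f y < g y → ∑ xs f < ∑ xs g
∑-mono-< f≤g (here refl) fy<gy = +-mono-<-≤ fy<gy (∑-mono-≤ (f≤g ∘ there))
∑-mono-< f≤g (there y∈)  fy<gy = +-mono-≤-< (f≤g (here refl)) (∑-mono-< (f≤g ∘ there) y∈ fy<gy)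

∑-member-≤ : y ∈ xs → f y ≤ ∑ xs f
∑-member-≤ {f = f} (here refl) = m≤m+n (f _) _
∑-member-≤ {f = f} (there y∈)  = ≤-trans (∑-member-≤ y∈) (m≤n+m _ (f _))

∑-single : Unique xs → y ∈ xs → (∀ {x} → x ∈ xs → x ≢ y → f x ≡ 0) → ∑ xs f ≡ f y
∑-single {f = f} (x∉xs ∷ _) (here refl) vanish =
  trans (cong (f _ +_) (∑-zero (λ x′∈ → vanish (there x′∈) (lookup x∉xs x′∈ ∘ sym))))
        (+-identityʳ _)
∑-single (x∉xs ∷ u) (there y∈) vanish =
  cong₂ _+_ (vanish (here refl) (λ { refl → lookup x∉xs y∈ refl })) (∑-single u y∈ (vanish ∘ there))

∑-at : ∀ {xs v} (g : ℕ → Bool) → Unique xs → v ∈ xs → ∑[ x ∈ xs ] 𝟙 ((x ≡ᵇ v) ∧ g x) ≡ 𝟙 (g v)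
∑-at {v = v} g u v∈ =
  trans (∑-single {f = λ x → 𝟙 ((x ≡ᵇ v) ∧ g x)} u v∈ λ {x} _ x≢v →
           cong (λ b → 𝟙 (b ∧ g x)) (≢⇒≡ᵇ-false x v x≢v))
        (cong (λ b → 𝟙 (b ∧ g v)) (to T-≡ (≡⇒≡ᵇ v v refl)))

∑-at-∉ : ∀ {xs v} (g : ℕ → Bool) → v ∉ xs → ∑[ x ∈ xs ] 𝟙 ((x ≡ᵇ v) ∧ g x) ≡ 0
∑-at-∉ {xs} {v} g v∉ =
  ∑-zero {xs = xs} (λ {x} x∈ → cong (λ b → 𝟙 (b ∧ g x)) (≢⇒≡ᵇ-false x v (λ { refl → v∉ x∈ })))

∑-≤-length : (∀ {x} → x ∈ xs → f x ≤ 1) → ∑ xs f ≤ length xs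
∑-≤-length {xs = xs} {f} f≤1 = subst (∑ xs f ≤_) (∑-1 xs) (∑-mono-≤ f≤1)

∑-saturated : (∀ {x} → x ∈ xs → f x ≤ 1) → ∑ xs f ≡ length xs → y ∈ xs → f y ≡ 1
∑-saturated {xs = x ∷ xs} {f} f≤1 full y∈ with f x in fx | f≤1 (here refl)
... | 0 | _ = ⊥-elim (1+n≰n (subst (_≤ length xs) full (∑-≤-length (f≤1 ∘ there))))
... | suc (suc _) | s≤s ()
... | 1 | _ with y∈
...   | here refl  = fx
...   | there y∈xs = ∑-saturated (f≤1 ∘ there) (suc-injective full) y∈xs

∑-𝟙-≤1 : Unique xs → (∀ {x y} → x ∈ xs → y ∈ xs → True (p x) → True (p y) → x ≡ y) →
         ∑[ x ∈ xs ] 𝟙 (p x) ≤ 1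
∑-𝟙-≤1 [] _ = z≤n
∑-𝟙-≤1 {xs = x ∷ xs} {p} (x∉xs ∷ u) unique with T? (p x)
... | yes px = ≤-reflexive (cong₂ _+_ (𝟙-true px) (∑-zero (λ y∈ → 𝟙-false (λ py →
                 lookup x∉xs y∈ (unique (here refl) (there y∈) px py)))))
... | no ¬px rewrite 𝟙-false ¬px = ∑-𝟙-≤1 u (λ x∈ y∈ → unique (there x∈) (there y∈))

count-mono : ∀ xs → (∀ {x} → x ∈ xs → True (p x) → True (q x)) → count p xs ≤ count q xs
count-mono {p = p} {q} xs p⇒q =
  subst₂ _≤_ (sym (count≡∑ p xs)) (sym (count≡∑ q xs)) (∑-mono-≤ (𝟙-mono ∘ p⇒q))

count-mono-< : ∀ xs → (∀ {x} → x ∈ xs → True (p x) → True (q x)) →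
               y ∈ xs → True (q y) → ¬ True (p y) → count p xs < count q xs
count-mono-< {p = p} {q} xs p⇒q y∈ qy ¬py =
  subst₂ _<_ (sym (count≡∑ p xs)) (sym (count≡∑ q xs))
    (∑-mono-< (𝟙-mono ∘ p⇒q) y∈ (subst₂ _<_ (sym (𝟙-false ¬py)) (sym (𝟙-true qy)) ≤-refl))

count-pos : y ∈ xs → True (p y) → 1 ≤ count p xs
count-pos {xs = xs} {p = p} y∈ py =
  subst (1 ≤_) (sym (count≡∑ p xs)) (≤-trans (≤-reflexive (sym (𝟙-true py))) (∑-member-≤ y∈))

count-≤-length : ∀ xs → count p xs ≤ length xs
count-≤-length {p = p} xs =
  subst (_≤ length xs) (sym (count≡∑ p xs)) (∑-≤-length {xs = xs} (λ {x} _ → 𝟙-≤1 (p x)))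

-- Intervals, pairs and the pigeonhole principle

InjectiveOn : List A → (A → B) → Set
InjectiveOn xs h = ∀ {x y} → x ∈ xs → y ∈ xs → h x ≡ h y → x ≡ y

∈-range1⁺ : ∀ {x m} → 1 ≤ x → x ≤ m → x ∈ range1 m
∈-range1⁺ (s≤s z≤n) x≤m = ∈-map⁺ suc (∈-upTo⁺ x≤m)

∈-range1⁻ : ∀ {x m} → x ∈ range1 m → 1 ≤ x × x ≤ m
∈-range1⁻ x∈ with ∈-map⁻ suc x∈
... | _ , x′∈ , refl = s≤s z≤n , ∈-upTo⁻ x′∈

range1-unique : ∀ m → Unique (range1 m)
range1-unique m = map⁺ suc-injective (upTo⁺ m)

length-range1 : ∀ m → length (range1 m) ≡ m
length-range1 m = trans (length-map suc (upTo m)) (length-upTo m)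

∑-range1-suc : ∀ m (f : ℕ → ℕ) → ∑[ a ∈ range1 (suc m) ] f a ≡ f 1 + ∑[ a ∈ range1 m ] f (suc a)
∑-range1-suc m f = cong (f 1 +_) (begin
    ∑ (map suc (applyUpTo suc m)) f   ≡⟨ cong (λ as → ∑ as f) (map-applyUpTo suc suc m) ⟩
    ∑ (applyUpTo (suc ∘ suc) m) f     ≡⟨ cong (λ as → ∑ as f) (sym (map-applyUpTo id (suc ∘ suc) m)) ⟩
    ∑ (map (suc ∘ suc) (upTo m)) f    ≡⟨ ∑-map (suc ∘ suc) (upTo m) f ⟩
    ∑[ a ∈ upTo m ] f (suc (suc a))   ≡⟨ sym (∑-map suc (upTo m) (f ∘ suc)) ⟩
    ∑[ a ∈ range1 m ] f (suc a)       ∎)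
  where open ≡-Reasoning

pairs : List A → (A → List B) → List (A × B)
pairs xs ys = concatMap (λ a → map (λ b → (a , b)) (ys a)) xs

∑-pairs : ∀ (xs : List A) (ys : A → List B) f →
          ∑ (pairs xs ys) f ≡ ∑[ a ∈ xs ] ∑[ b ∈ ys a ] f (a , b)
∑-pairs []       ys f = refl
∑-pairs (x ∷ xs) ys f =
  trans (∑-++ (map (x ,_) (ys x)) _ f) (cong₂ _+_ (∑-map (x ,_) (ys x) f) (∑-pairs xs ys f))

count-pairs : ∀ (p : A × B → Bool) xs ys →
              count p (pairs xs ys) ≡ ∑[ a ∈ xs ] ∑[ b ∈ ys a ] 𝟙 (p (a , b))
count-pairs p xs ys = trans (count≡∑ p (pairs xs ys)) (∑-pairs xs ys (𝟙 ∘ p))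

length-pairs : ∀ (xs : List A) (ys : A → List B) → length (pairs xs ys) ≡ ∑[ a ∈ xs ] length (ys a)
length-pairs xs ys = begin
  length (pairs xs ys)               ≡⟨ sym (∑-1 (pairs xs ys)) ⟩
  ∑[ _ ∈ pairs xs ys ] 1             ≡⟨ ∑-pairs xs ys _ ⟩
  ∑[ a ∈ xs ] ∑[ _ ∈ ys a ] 1        ≡⟨ ∑-cong {xs = xs} (λ {a} _ → ∑-1 (ys a)) ⟩
  ∑[ a ∈ xs ] length (ys a)          ∎
  where open ≡-Reasoning

∈-pairs⁺ : ∀ {xs : List A} {ys : A → List B} {a b} → a ∈ xs → b ∈ ys a → (a , b) ∈ pairs xs ys
∈-pairs⁺ (here refl) b∈ = ∈-++⁺ˡ (∈-map⁺ (_ ,_) b∈)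
∈-pairs⁺ {ys = ys} (there {x = x} a∈) b∈ = ∈-++⁺ʳ (map (x ,_) (ys x)) (∈-pairs⁺ a∈ b∈)

∈-pairs⁻ : ∀ (xs : List A) {ys : A → List B} {a b} → (a , b) ∈ pairs xs ys → a ∈ xs × b ∈ ys a
∈-pairs⁻ (x ∷ xs) {ys} ab∈ with ∈-++⁻ (map (x ,_) (ys x)) ab∈
... | inj₁ ab∈row with ∈-map⁻ (x ,_) ab∈row
...   | _ , b∈ , refl = here refl , b∈
∈-pairs⁻ (x ∷ xs) {ys} ab∈ | inj₂ ab∈rest with ∈-pairs⁻ xs ab∈rest
...   | a∈ , b∈ = there a∈ , b∈

pairs-unique : ∀ {xs : List A} {ys : A → List B} → Unique xs → (∀ a → Unique (ys a)) →
               Unique (pairs xs ys)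
pairs-unique [] _ = []
pairs-unique {xs = x ∷ xs} {ys} (x∉xs ∷ u) ys-unique =
  ++⁺ (map⁺ (cong proj₂) (ys-unique x)) (pairs-unique u ys-unique) disjoint
  where
  disjoint : ∀ {v} → ¬ (v ∈ map (x ,_) (ys x) × v ∈ pairs xs ys)
  disjoint (v∈row , v∈rest) with ∈-map⁻ (x ,_) v∈row
  ... | _ , _ , refl = lookup x∉xs (proj₁ (∈-pairs⁻ xs v∈rest)) refl

-- Pigeonhole: an injection from a duplicate-free list into [1..length] is onto.
∑-fibre≡1 : ∀ {xs : List A} {h : A → ℕ} {t} → Unique xs → InjectiveOn xs h →
            (∀ {x} → x ∈ xs → h x ∈ range1 (length xs)) →
            t ∈ range1 (length xs) → ∑[ x ∈ xs ] 𝟙 (t ≡ᵇ h x) ≡ 1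
∑-fibre≡1 {xs = xs} {h} u h-inj h-into t∈ = ∑-saturated (λ {t} _ → fibre≤1 t) total t∈
  where
  N : ℕ
  N = length xs

  fibre≤1 : ∀ t → ∑[ x ∈ xs ] 𝟙 (t ≡ᵇ h x) ≤ 1
  fibre≤1 t = ∑-𝟙-≤1 u (λ x∈ y∈ t≡hx t≡hy →
    h-inj x∈ y∈ (trans (sym (≡ᵇ⇒≡ t _ t≡hx)) (≡ᵇ⇒≡ t _ t≡hy)))

  total : ∑[ t ∈ range1 N ] ∑[ x ∈ xs ] 𝟙 (t ≡ᵇ h x) ≡ length (range1 N)
  total = begin
    ∑[ t ∈ range1 N ] ∑[ x ∈ xs ] 𝟙 (t ≡ᵇ h x)   ≡⟨ ∑-swap (range1 N) xs _ ⟩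
    ∑[ x ∈ xs ] ∑[ t ∈ range1 N ] 𝟙 (t ≡ᵇ h x)   ≡⟨ ∑-cong {xs = xs} (λ {x} x∈ →
                                                      ∑-single (range1-unique N) (h-into x∈)
                                                        (λ _ t≢hx → 𝟙-false (t≢hx ∘ ≡ᵇ⇒≡ _ _))
                                                      ⟨ trans ⟩ 𝟙-true (≡⇒≡ᵇ (h x) _ refl)) ⟩
    ∑[ x ∈ xs ] 1                                ≡⟨ ∑-1 xs ⟩
    N                                            ≡⟨ sym (length-range1 N) ⟩
    length (range1 N)                            ∎
    where open ≡-Reasoning

-- Preimages

search : (ℕ → Bool) → List ℕ → Maybe ℕ
search p []       = nothing
search p (x ∷ xs) = if p x then just x else search p xs

search-just : ∀ {p} xs {x} → search p xs ≡ just x → x ∈ xs × True (p x)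
search-just {p} (y ∷ ys) found with p y in py
... | true  with found
...   | refl = here refl , subst True (sym py) _
search-just (y ∷ ys) found | false with search-just ys found
...   | x∈ , px = there x∈ , px

search-nothing : ∀ {p} xs {x} → search p xs ≡ nothing → x ∈ xs → ¬ True (p x)
search-nothing {p} (y ∷ ys) missing x∈ with p y in py
search-nothing (y ∷ ys) () x∈ | true
... | false with x∈
...   | here refl = λ px → subst True py px
...   | there x∈ys = search-nothing ys missing x∈ys

search-clauses : ∀ {p} (go : List ℕ → Maybe ℕ) → go [] ≡ nothing →
                 (∀ x xs → go (x ∷ xs) ≡ (if p x then just x else go xs)) →
                 ∀ xs → go xs ≡ search p xs
search-clauses go go-[] go-∷ []       = go-[]
search-clauses go go-[] go-∷ (x ∷ xs) =
  trans (go-∷ x xs) (cong (if _ then just x else_) (search-clauses go go-[] go-∷ xs))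

-- `preimage` searches through a local function of `Defs`. Abstracting `range1 n` leaves it
-- applied to a variable, where unification identifies it with the `go` of `search-clauses`.
preimage≡search : ∀ n w t → preimage n w t ≡ search (λ i → w i ≡ᵇ t) (range1 n)
preimage≡search n w t with range1 n | search-clauses {p = λ i → w i ≡ᵇ t} _ refl (λ _ _ → refl)
... | xs | go≡search = go≡search xs

module _ (n : ℕ) (w : ℕ → ℕ) where

  preimage-just : ∀ {t c} → preimage n w t ≡ just c → c ∈ range1 n × w c ≡ t
  preimage-just found with search-just (range1 n) (trans (sym (preimage≡search n w _)) found)
  ... | c∈ , wc≡t = c∈ , ≡ᵇ⇒≡ _ _ wc≡t

  preimage-nothing : ∀ {t c} → preimage n w t ≡ nothing → c ∈ range1 n → w c ≢ t
  preimage-nothing missing c∈ wc≡t =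
    search-nothing (range1 n) (trans (sym (preimage≡search n w _)) missing) c∈ (≡⇒≡ᵇ _ _ wc≡t)

  module _ (w-inj : InjectiveOn (range1 n) w) where

    preimage-image : ∀ {c} → c ∈ range1 n → preimage n w (w c) ≡ just c
    preimage-image {c} c∈ with preimage n w (w c) in e
    ... | nothing = ⊥-elim (preimage-nothing e c∈ refl)
    ... | just c′ with preimage-just e
    ...   | c′∈ , wc′≡wc = cong just (w-inj c′∈ c∈ wc′≡wc)

    ∑-preimage : ∀ (R : ℕ → ℕ) t → ∑[ c ∈ range1 n ] (𝟙 (w c ≡ᵇ t) * R c) ≡ maybe′ R 0 (preimage n w t)
    ∑-preimage R t with preimage n w t in e
    ... | nothing = ∑-zero (λ c∈ → cong (_* R _) (𝟙-false (preimage-nothing e c∈ ∘ ≡ᵇ⇒≡ _ _)))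
    ... | just c₀ with preimage-just e
    ...   | c₀∈ , wc₀≡t =
      trans (∑-single (range1-unique n) c₀∈ (λ c∈ c≢c₀ → cong (_* R _)
              (𝟙-false (λ wc≡t → c≢c₀ (w-inj c∈ c₀∈ (trans (≡ᵇ⇒≡ _ _ wc≡t) (sym wc₀≡t)))))))
            (trans (cong (_* R c₀) (𝟙-true (≡⇒≡ᵇ _ _ wc₀≡t))) (*-identityˡ (R c₀)))

-- Reading order

_⊑_ : ℕ × ℕ → ℕ × ℕ → Set
(p , q) ⊑ (a , b) = b < q ⊎ (q ≡ b × p ≤ a)

_⊏_ : ℕ × ℕ → ℕ × ℕ → Set
(p , q) ⊏ (a , b) = b < q ⊎ (q ≡ b × p < a)

-- `readingT s Λ a b` is by definition `count (_⊑ᵇ (a , b)) (cells s Λ)`.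
_⊑ᵇ_ : ℕ × ℕ → ℕ × ℕ → Bool
(p , q) ⊑ᵇ (a , b) = (b <ᵇ q) ∨ ((q ≡ᵇ b) ∧ (p ≤ᵇ a))

⊑ᵇ⇒⊑ : ∀ x y → True (x ⊑ᵇ y) → x ⊑ y
⊑ᵇ⇒⊑ (p , q) (a , b) x⊑y with to T-∨ x⊑y
... | inj₁ b<q          = inj₁ (<ᵇ⇒< b q b<q)
... | inj₂ q≡b∧p≤a with to T-∧ q≡b∧p≤a
...   | q≡b , p≤a = inj₂ (≡ᵇ⇒≡ q b q≡b , ≤ᵇ⇒≤′ p a p≤a)

⊑⇒⊑ᵇ : ∀ x y → x ⊑ y → True (x ⊑ᵇ y)
⊑⇒⊑ᵇ (p , q) (a , b) (inj₁ b<q)        = from T-∨ (inj₁ (<⇒<ᵇ b<q))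
⊑⇒⊑ᵇ (p , q) (a , b) (inj₂ (q≡b , p≤a)) = from T-∨ (inj₂ (from T-∧ (≡⇒≡ᵇ q b q≡b , ≤⇒≤ᵇ′ p≤a)))

⊑-refl : ∀ {x} → x ⊑ x
⊑-refl = inj₂ (refl , ≤-refl)

⊑-trans : ∀ {x y z} → x ⊑ y → y ⊑ z → x ⊑ z
⊑-trans (inj₁ b<q)        (inj₁ c<b)        = inj₁ (<-trans c<b b<q)
⊑-trans (inj₁ b<q)        (inj₂ (refl , _)) = inj₁ b<q
⊑-trans (inj₂ (refl , _)) (inj₁ c<b)        = inj₁ c<b
⊑-trans (inj₂ (refl , p≤a)) (inj₂ (refl , a≤c)) = inj₂ (refl , ≤-trans p≤a a≤c)

⊑-antisym : ∀ {x y} → x ⊑ y → y ⊑ x → x ≡ y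
⊑-antisym (inj₁ b<q)          (inj₁ q<b)          = ⊥-elim (<-asym b<q q<b)
⊑-antisym (inj₁ b<q)          (inj₂ (refl , _))   = ⊥-elim (<-irrefl refl b<q)
⊑-antisym (inj₂ (refl , _))   (inj₁ q<q)          = ⊥-elim (<-irrefl refl q<q)
⊑-antisym (inj₂ (refl , p≤a)) (inj₂ (_ , a≤p))    = cong (_, _) (≤-antisym p≤a a≤p)

⊏⇒⊑ : ∀ {x y} → x ⊏ y → x ⊑ y
⊏⇒⊑ (inj₁ b<q)          = inj₁ b<q
⊏⇒⊑ (inj₂ (q≡b , p<a)) = inj₂ (q≡b , <⇒≤ p<a)

⊏⇒⋣ : ∀ {x y} → x ⊏ y → ¬ y ⊑ x
⊏⇒⋣ (inj₁ b<q)          (inj₁ q<b)        = <-asym b<q q<b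
⊏⇒⋣ (inj₁ b<q)          (inj₂ (refl , _)) = <-irrefl refl b<q
⊏⇒⋣ (inj₂ (refl , _))   (inj₁ q<q)        = <-irrefl refl q<q
⊏⇒⋣ (inj₂ (_ , p<a))    (inj₂ (_ , a≤p))  = <⇒≱ p<a a≤p

⊏-or-⊒ : ∀ x y → x ⊏ y ⊎ y ⊑ x
⊏-or-⊒ (p , q) (a , b) with <-cmp b q
... | tri< b<q _ _ = inj₁ (inj₁ b<q)
... | tri> _ _ q<b = inj₂ (inj₁ q<b)
... | tri≈ _ refl _ with <-cmp p a
...   | tri< p<a _ _ = inj₁ (inj₂ (refl , p<a))
...   | tri≈ _ p≡a _ = inj₂ (inj₂ (refl , ≤-reflexive (sym p≡a)))
...   | tri> _ _ a<p = inj₂ (inj₂ (refl , <⇒≤ a<p))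

⊏-above : ∀ {i j p q} → i < p → ((i , j) ⊏ (p , q) ⇔ q ≤ j)
⊏-above i<p = mk⇔ (λ { (inj₁ q<j) → <⇒≤ q<j ; (inj₂ (refl , _)) → ≤-refl })
                   (λ q≤j → [ inj₁ , (λ q≡j → inj₂ (sym q≡j , i<p)) ]′ (m≤n⇒m<n∨m≡n q≤j))

⊏-below : ∀ {i j p q} → p ≤ i → ((i , j) ⊏ (p , q) ⇔ q < j)
⊏-below p≤i = mk⇔ (λ { (inj₁ q<j) → q<j ; (inj₂ (_ , i<p)) → ⊥-elim (<⇒≱ i<p p≤i) }) inj₁

-- Inversions and diagonal inversions at a single cell

-- `IT1` and `IT2` test each cell with a local `with`-function of `Defs`; `scan` is that
-- function, recovered by unification, and `by-cases` evaluates it.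
IT1-maybe : ∀ s Λ T n w c i → IT1 s Λ T n w c i ≡
  anyᵇ (λ j → maybe′ (λ l → (c <ᵇ l) ∧ (w l <ᵇ w c)) false (PRD s Λ T n w i j)) (range1 (Λ i))
IT1-maybe s Λ T n w c i = trans unfold (anyᵇ-cong (range1 (Λ i)) by-cases)
  where
  scan : ℕ → Bool
  scan = _
  unfold : IT1 s Λ T n w c i ≡ anyᵇ scan (range1 (Λ i))
  unfold = refl
  by-cases : ∀ j → scan j ≡ maybe′ (λ l → (c <ᵇ l) ∧ (w l <ᵇ w c)) false (PRD s Λ T n w i j)
  by-cases j with PRD s Λ T n w i j
  ... | just l  = refl
  ... | nothing = refl

IT2-maybe : ∀ s Λ T n w c i → IT2 s Λ T n w c i ≡
  anyᵇ (λ j → maybe′ (λ _ → false) (T i j <ᵇ w c) (PRD s Λ T n w i j)) (range1 (Λ i))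
IT2-maybe s Λ T n w c i = trans unfold (anyᵇ-cong (range1 (Λ i)) by-cases)
  where
  scan : ℕ → Bool
  scan = _
  unfold : IT2 s Λ T n w c i ≡ anyᵇ scan (range1 (Λ i))
  unfold = refl
  by-cases : ∀ j → scan j ≡ maybe′ (λ _ → false) (T i j <ᵇ w c) (PRD s Λ T n w i j)
  by-cases j with PRD s Λ T n w i j
  ... | just l  = refl
  ... | nothing = refl

inverts : Maybe ℕ → ℕ → Bool
inverts nothing  c = true
inverts (just l) c = c <ᵇ l

inverts⇒ : ∀ μ {c} → True (inverts μ c) → μ ≡ nothing ⊎ ∃ λ l → μ ≡ just l × c < l
inverts⇒ nothing  _   = inj₁ refl
inverts⇒ (just l) c<l = inj₂ (l , refl , <ᵇ⇒< _ l c<l)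

diagInv-just : ∀ (ψ : PartialFilling) {i j p q c} → ψ p q ≡ just c →
               diagInv ψ (i , j) (p , q) ≡ inverts (ψ i j) c
diagInv-just ψ {i} {j} ψpq≡c rewrite ψpq≡c with ψ i j
... | just _  = refl
... | nothing = refl

diagInv-nothing : ∀ (ψ : PartialFilling) {i j p q} → ψ p q ≡ nothing → diagInv ψ (i , j) (p , q) ≡ false
diagInv-nothing ψ {i} {j} ψpq≡∅ rewrite ψpq≡∅ with ψ i j
... | just _  = refl
... | nothing = refl

attacking-above : ∀ {i p} → i < p → ∀ j q → attacking (i , j) (p , q) ≡ (j ≡ᵇ q)
attacking-above {i} {p} i<p j q
  rewrite to T-≡ (<⇒<ᵇ i<p) | ≮⇒<ᵇ-false p i (<⇒≯ i<p) | ∧-zeroʳ (j ≡ᵇ suc q)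
  = trans (∨-identityʳ _) (∧-identityʳ (j ≡ᵇ q))

attacking-below : ∀ {i p} → p < i → ∀ j q → attacking (i , j) (p , q) ≡ (j ≡ᵇ suc q)
attacking-below {i} {p} p<i j q
  rewrite to T-≡ (<⇒<ᵇ p<i) | ≮⇒<ᵇ-false i p (<⇒≯ p<i) | ∧-zeroʳ (j ≡ᵇ q)
  = ∧-identityʳ (j ≡ᵇ suc q)

attacking-same-row : ∀ p j q → attacking (p , j) (p , q) ≡ false
attacking-same-row p j q
  rewrite ≮⇒<ᵇ-false p p (<-irrefl refl) | ∧-zeroʳ (j ≡ᵇ q) | ∧-zeroʳ (j ≡ᵇ suc q) = refl

-- Ranks and admissible fillings

module ReadingOrder (s : ℕ) (Λ : ℕ → ℕ) where

  T : ℕ → ℕ → ℕ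
  T = readingT s Λ

  rank : ℕ × ℕ → ℕ
  rank (a , b) = T a b

  N : ℕ
  N = length (cells s Λ)

  cells-unique : Unique (cells s Λ)
  cells-unique = pairs-unique (range1-unique s) (λ a → range1-unique (Λ a))

  rank-mono : ∀ x y → x ⊑ y → rank x ≤ rank y
  rank-mono x y x⊑y = count-mono (cells s Λ) λ {z} _ z⊑x →
    ⊑⇒⊑ᵇ z y (⊑-trans (⊑ᵇ⇒⊑ z x z⊑x) x⊑y)

  rank-mono-< : ∀ x y → y ∈ cells s Λ → x ⊏ y → rank x < rank y
  rank-mono-< x y y∈ x⊏y = count-mono-< (cells s Λ)
    (λ {z} _ z⊑x → ⊑⇒⊑ᵇ z y (⊑-trans (⊑ᵇ⇒⊑ z x z⊑x) (⊏⇒⊑ x⊏y)))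
    y∈ (⊑⇒⊑ᵇ y y ⊑-refl) (⊏⇒⋣ x⊏y ∘ ⊑ᵇ⇒⊑ y x)

  rank-<⇔⊏ : ∀ x y → y ∈ cells s Λ → (rank x < rank y ⇔ x ⊏ y)
  rank-<⇔⊏ x y y∈ = mk⇔
    (λ rx<ry → [ id , (λ y⊑x → ⊥-elim (<⇒≱ rx<ry (rank-mono y x y⊑x))) ]′ (⊏-or-⊒ x y))
    (rank-mono-< x y y∈)

  rank-injective : InjectiveOn (cells s Λ) rank
  rank-injective {x} {y} x∈ y∈ rx≡ry with ⊏-or-⊒ x y | ⊏-or-⊒ y x
  ... | inj₁ x⊏y | _        = ⊥-elim (<-irrefl rx≡ry (rank-mono-< x y y∈ x⊏y))
  ... | inj₂ _   | inj₁ y⊏x = ⊥-elim (<-irrefl (sym rx≡ry) (rank-mono-< y x x∈ y⊏x))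
  ... | inj₂ y⊑x | inj₂ x⊑y = ⊑-antisym x⊑y y⊑x

  rank-∈ : ∀ {x} → x ∈ cells s Λ → rank x ∈ range1 N
  rank-∈ {x} x∈ = ∈-range1⁺ (count-pos x∈ (⊑⇒⊑ᵇ x x ⊑-refl)) (count-≤-length (cells s Λ))

  rank-fibre : ∀ {t} → t ∈ range1 N → ∑[ y ∈ cells s Λ ] 𝟙 (t ≡ᵇ rank y) ≡ 1
  rank-fibre = ∑-fibre≡1 cells-unique rank-injective rank-∈

  cell⇒inShape : ∀ {a b} → (a , b) ∈ cells s Λ → True (inShape s Λ a b)
  cell⇒inShape ab∈ with ∈-pairs⁻ (range1 s) ab∈
  ... | a∈ , b∈ with ∈-range1⁻ a∈ | ∈-range1⁻ b∈
  ...   | 1≤a , a≤s | 1≤b , b≤Λa =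
    from T-∧ (≤⇒≤ᵇ′ 1≤a , from T-∧ (≤⇒≤ᵇ′ a≤s , from T-∧ (≤⇒≤ᵇ′ 1≤b , ≤⇒≤ᵇ′ b≤Λa)))

  inShape⇒cell : ∀ {a b} → True (inShape s Λ a b) → (a , b) ∈ cells s Λ
  inShape⇒cell {a} {b} shape with to T-∧ shape
  ... | 1≤a , shape′ with to T-∧ shape′
  ...   | a≤s , shape″ with to T-∧ shape″
  ...     | 1≤b , b≤Λa = ∈-pairs⁺ (∈-range1⁺ (≤ᵇ⇒≤′ 1 a 1≤a) (≤ᵇ⇒≤′ a s a≤s))
                                  (∈-range1⁺ (≤ᵇ⇒≤′ 1 b 1≤b) (≤ᵇ⇒≤′ b (Λ a) b≤Λa))

  module Filling (n : ℕ) (w : ℕ → ℕ) (w-injective : InjectiveOn (range1 n) w) where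

    φ : PartialFilling
    φ = PRD s Λ T n w

    φ-cell : ∀ {a b} → (a , b) ∈ cells s Λ → φ a b ≡ preimage n w (T a b)
    φ-cell {a} {b} ab∈ = cong (if_then preimage n w (T a b) else nothing) (to T-≡ (cell⇒inShape ab∈))

    φ-just : ∀ {a b c} → φ a b ≡ just c → (a , b) ∈ cells s Λ × c ∈ range1 n × w c ≡ T a b
    φ-just {a} {b} φab≡c with if-then-nothing (inShape s Λ a b) φab≡c
    ... | shape , found = inShape⇒cell shape , preimage-just n w found

    φ-image : ∀ {a b c} → (a , b) ∈ cells s Λ → c ∈ range1 n → w c ≡ T a b → φ a b ≡ just c
    φ-image ab∈ c∈ wc≡T =
      trans (φ-cell ab∈) (subst (λ t → preimage n w t ≡ just _) wc≡T (preimage-image n w w-injective c∈))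

    DecreasingRows : Set
    DecreasingRows = ∀ {a b c} → φ a b ≡ just c → b < Λ a → ∃ λ c′ → φ a (suc b) ≡ just c′ × c′ < c

    admissible⇒decreasing : ∀ {k} → Admissible s Λ T n k w → DecreasingRows
    admissible⇒decreasing (_ , next-label) {a} {b} {c} φab≡c b<Λa with φ-just φab≡c
    ... | ab∈ , c∈ , wc≡T with ∈-pairs⁻ (range1 s) ab∈ | ∈-range1⁻ c∈
    ...   | a∈ , b∈ | 1≤c , c≤n with ∈-range1⁻ a∈ | ∈-range1⁻ b∈
    ...     | 1≤a , a≤s | 1≤b , b≤Λa with next-label c a b 1≤c c≤n 1≤a a≤s 1≤b b≤Λa (sym wc≡T)
    ...       | inj₁ b≡Λa = ⊥-elim (<-irrefl b≡Λa b<Λa)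
    ...       | inj₂ (c′ , 1≤c′ , c′<c , T≡wc′) =
      c′ , φ-image (∈-pairs⁺ a∈ (∈-range1⁺ (s≤s z≤n) b<Λa))
                   (∈-range1⁺ 1≤c′ (≤-trans (<⇒≤ c′<c) c≤n)) (sym T≡wc′) , c′<c

    module Rows (decreasing : DecreasingRows) where

      suffix : ∀ {a b b′ c} → φ a b ≡ just c → b ≤ b′ → b′ ≤ Λ a → ∃ λ c′ → φ a b′ ≡ just c′ × c′ ≤ c
      suffix {b′ = zero} φab≡c z≤n _ = _ , φab≡c , ≤-refl
      suffix {b′ = suc b′} φab≡c b≤b′ b′<Λa with m≤n⇒m<n∨m≡n b≤b′
      ... | inj₂ refl = _ , φab≡c , ≤-refl
      ... | inj₁ (s≤s b≤b′-1) with suffix φab≡c b≤b′-1 (<⇒≤ b′<Λa)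
      ...   | c′ , φab′≡c′ , c′≤c with decreasing φab′≡c′ b′<Λa
      ...     | c″ , φasb′≡c″ , c″<c′ = c″ , φasb′≡c″ , ≤-trans (<⇒≤ c″<c′) c′≤c

      IsInversion : ℕ → ℕ → Bool
      IsInversion c i = IT1 s Λ T n w c i ∨ (not (IT1 s Λ T n w c i) ∧ IT2 s Λ T n w c i)

      RowWitness : ℕ → ℕ → Set
      RowWitness c i = ∃ λ j → j ∈ range1 (Λ i) × T i j < w c × True (inverts (φ i j) c)

      inversion⇔witness : ∀ c i → True (IsInversion c i) ⇔ RowWitness c i
      inversion⇔witness c i = mk⇔ (witness ∘ to (True-or-else _ _)) (from (True-or-else _ _) ∘ inversion)
        where
        witness : True (IT1 s Λ T n w c i) ⊎ True (IT2 s Λ T n w c i) → RowWitness c i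
        witness (inj₁ it1) with anyᵇ⇒∃ (range1 (Λ i)) (subst True (IT1-maybe s Λ T n w c i) it1)
        ... | j , j∈ , test with True-maybe-just (φ i j) test
        ...   | l , φij≡l , test′ with to T-∧ test′ | φ-just φij≡l
        ...     | c<l , wl<wc | _ , _ , wl≡T =
          j , j∈ , subst (_< w c) wl≡T (<ᵇ⇒< _ _ wl<wc) , subst (λ μ → True (inverts μ c)) (sym φij≡l) c<l
        witness (inj₂ it2) with anyᵇ⇒∃ (range1 (Λ i)) (subst True (IT2-maybe s Λ T n w c i) it2)
        ... | j , j∈ , test with True-maybe-nothing {T i j <ᵇ w c} (φ i j) test
        ...   | φij≡∅ , T<wc = j , j∈ , <ᵇ⇒< _ _ T<wc , subst (λ μ → True (inverts μ c)) (sym φij≡∅) _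

        inversion : RowWitness c i → True (IT1 s Λ T n w c i) ⊎ True (IT2 s Λ T n w c i)
        inversion (j , j∈ , T<wc , inv) with inverts⇒ (φ i j) inv
        ... | inj₁ φij≡∅ = inj₂ (subst True (sym (IT2-maybe s Λ T n w c i))
                (∃⇒anyᵇ j∈ (subst (λ μ → True (maybe′ (λ _ → false) (T i j <ᵇ w c) μ)) (sym φij≡∅)
                  (<⇒<ᵇ T<wc))))
        ... | inj₂ (l , φij≡l , c<l) with φ-just φij≡l
        ...   | _ , _ , wl≡T = inj₁ (subst True (sym (IT1-maybe s Λ T n w c i))
                (∃⇒anyᵇ j∈ (subst (λ μ → True (maybe′ (λ l → (c <ᵇ l) ∧ (w l <ᵇ w c)) false μ))
                  (sym φij≡l) (from T-∧ (<⇒<ᵇ c<l , <⇒<ᵇ (subst (_< w c) (sym wl≡T) T<wc))))))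

      module Threshold {c i m} (1≤m : 1 ≤ m) (threshold : ∀ j → T i j < w c ⇔ m ≤ j) where

        inversion-at : m ≤ Λ i → IsInversion c i ≡ inverts (φ i m) c
        inversion-at m≤Λi = True-⇔⇒≡ (mk⇔ inverts-at-m (from (inversion⇔witness c i) ∘ witness-at-m))
          where
          witness-at-m : True (inverts (φ i m) c) → RowWitness c i
          witness-at-m inv = m , ∈-range1⁺ 1≤m m≤Λi , from (threshold m) ≤-refl , inv

          inverts-at-m : True (IsInversion c i) → True (inverts (φ i m) c)
          inverts-at-m inv with to (inversion⇔witness c i) inv
          ... | j , j∈ , T<wc , invj with φ i m in φim
          ...   | nothing = _
          ...   | just l with suffix φim (to (threshold j) T<wc) (proj₂ (∈-range1⁻ j∈))
          ...     | l′ , φij≡l′ , l′≤l with inverts⇒ (φ i j) invj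
          ...       | inj₁ φij≡∅ = case trans (sym φij≡l′) φij≡∅ of λ ()
          ...       | inj₂ (l″ , φij≡l″ , c<l″) with trans (sym φij≡l′) φij≡l″
          ...         | refl = <⇒<ᵇ (<-≤-trans c<l″ l′≤l)

        inversion-beyond : Λ i < m → IsInversion c i ≡ false
        inversion-beyond Λi<m = ¬True⇒≡false λ inv → case to (inversion⇔witness c i) inv of λ
          { (j , j∈ , T<wc , _) → <⇒≱ Λi<m (≤-trans (to (threshold j) T<wc) (proj₂ (∈-range1⁻ j∈))) }

      threshold-via-⊏ : ∀ {p q c i m} → (p , q) ∈ cells s Λ → w c ≡ T p q →
                        (∀ j → (i , j) ⊏ (p , q) ⇔ m ≤ j) → ∀ j → T i j < w c ⇔ m ≤ j
      threshold-via-⊏ {p} {q} {c} {i} pq∈ wc≡T ⊏⇔ j =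
        ⊏⇔ j ⇔-∘ (rank-<⇔⊏ (i , j) (p , q) pq∈
              ⇔-∘ mk⇔ (subst (T i j <_) wc≡T) (subst (T i j <_) (sym wc≡T)))

      attacksInRow : ℕ → ℕ → ℕ → ℕ
      attacksInRow p q i = ∑[ j ∈ range1 (Λ i) ] 𝟙 (attacking (i , j) (p , q) ∧ diagInv φ (i , j) (p , q))

      attacksInRow-column : ∀ {p q c i v} → φ p q ≡ just c →
                            (∀ {j} → attacking (i , j) (p , q) ≡ (j ≡ᵇ v)) →
                            attacksInRow p q i ≡ ∑[ j ∈ range1 (Λ i) ] 𝟙 ((j ≡ᵇ v) ∧ inverts (φ i j) c)
      attacksInRow-column {i = i} φpq≡c column = ∑-cong {xs = range1 (Λ i)} λ {j} _ →
        cong 𝟙 (cong₂ _∧_ (column {j}) (diagInv-just φ {i} {j} φpq≡c))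

      module Below {p q c i} (φpq≡c : φ p q ≡ just c) (p≤i : p ≤ i) =
        Threshold (s≤s z≤n) (threshold-via-⊏ (proj₁ (φ-just φpq≡c)) (proj₂ (proj₂ (φ-just φpq≡c)))
                                             (λ j → ⊏-below p≤i))

      attacks-above : ∀ {p q c i} → φ p q ≡ just c → i < p → q ≤ Λ i →
                      attacksInRow p q i ≡ 𝟙 (IsInversion c i)
      attacks-above {p} {q} {c} {i} φpq≡c i<p q≤Λi with φ-just φpq≡c
      ... | pq∈ , _ , wc≡T with ∈-range1⁻ (proj₂ (∈-pairs⁻ (range1 s) pq∈))
      ...   | 1≤q , _ =
        attacksInRow-column φpq≡c (λ {j} → attacking-above i<p j q)
        ⟨ trans ⟩ ∑-at _ (range1-unique (Λ i)) (∈-range1⁺ 1≤q q≤Λi)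
        ⟨ trans ⟩ cong 𝟙 (sym (Above.inversion-at q≤Λi))
        where module Above = Threshold 1≤q (threshold-via-⊏ pq∈ wc≡T (λ j → ⊏-above i<p))

      attacks-below : ∀ {p q c i} → φ p q ≡ just c → p < i → attacksInRow p q i ≡ 𝟙 (IsInversion c i)
      attacks-below {p} {q} {c} {i} φpq≡c p<i =
        trans (attacksInRow-column φpq≡c (λ {j} → attacking-below p<i j q)) in-column
        where
        in-column : ∑[ j ∈ range1 (Λ i) ] 𝟙 ((j ≡ᵇ suc q) ∧ inverts (φ i j) c) ≡ 𝟙 (IsInversion c i)
        in-column with suc q ≤? Λ i
        ... | yes q<Λi = ∑-at _ (range1-unique (Λ i)) (∈-range1⁺ (s≤s z≤n) q<Λi)
                         ⟨ trans ⟩ cong 𝟙 (sym (Below.inversion-at φpq≡c (<⇒≤ p<i) q<Λi))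
        ... | no q≮Λi  = ∑-at-∉ _ (q≮Λi ∘ proj₂ ∘ ∈-range1⁻)
                         ⟨ trans ⟩ cong 𝟙 (sym (Below.inversion-beyond φpq≡c (<⇒≤ p<i) (≰⇒> q≮Λi)))

      attacks-same-row : ∀ {p q c} → φ p q ≡ just c → attacksInRow p q p ≡ 𝟙 (IsInversion c p)
      attacks-same-row {p} {q} {c} φpq≡c =
        trans (∑-zero {xs = range1 (Λ p)} λ {j} _ →
                 cong (λ b → 𝟙 (b ∧ diagInv φ (p , j) (p , q))) (attacking-same-row p j q))
              (cong 𝟙 (sym no-inversion))
        where
        no-inversion : IsInversion c p ≡ false
        no-inversion with suc q ≤? Λ p
        ... | no q≮Λp = Below.inversion-beyond φpq≡c ≤-refl (≰⇒> q≮Λp)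
        ... | yes q<Λp with decreasing φpq≡c q<Λp
        ...   | c′ , φpq′≡c′ , c′<c = begin
          IsInversion c p              ≡⟨ Below.inversion-at φpq≡c ≤-refl q<Λp ⟩
          inverts (φ p (suc q)) c      ≡⟨ cong (λ μ → inverts μ c) φpq′≡c′ ⟩
          c <ᵇ c′                      ≡⟨ ≮⇒<ᵇ-false c c′ (<⇒≯ c′<c) ⟩
          false                        ∎
          where open ≡-Reasoning

      inversionsOf : ℕ → ℕ
      inversionsOf c = ∑[ i ∈ range1 s ] 𝟙 (IsInversion c i)

      inv≡∑ : inv s Λ T n w ≡ ∑[ c ∈ range1 n ] inversionsOf c
      inv≡∑ = count-pairs _ (range1 n) (λ _ → range1 s)

      module _ (Λ-antitone : ∀ {i p} → 1 ≤ i → i ≤ p → Λ p ≤ Λ i) where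

        attacks-in-row : ∀ {p q c i} → φ p q ≡ just c → i ∈ range1 s →
                         attacksInRow p q i ≡ 𝟙 (IsInversion c i)
        attacks-in-row {p} {q} {c} {i} φpq≡c i∈ with <-cmp i p
        ... | tri< i<p _ _  = attacks-above φpq≡c i<p (≤-trans q≤Λp Λp≤Λi)
          where
          q≤Λp : q ≤ Λ p
          q≤Λp = proj₂ (∈-range1⁻ (proj₂ (∈-pairs⁻ (range1 s) (proj₁ (φ-just φpq≡c)))))
          Λp≤Λi : Λ p ≤ Λ i
          Λp≤Λi = Λ-antitone (proj₁ (∈-range1⁻ i∈)) (<⇒≤ i<p)
        ... | tri≈ _ refl _ = attacks-same-row φpq≡c
        ... | tri> _ _ p<i  = attacks-below φpq≡c p<i

        attacks-on : ∀ p q → ∑[ x ∈ cells s Λ ] 𝟙 (attacking x (p , q) ∧ diagInv φ x (p , q))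
                             ≡ maybe′ inversionsOf 0 (φ p q)
        attacks-on p q = by-content (φ p q) refl
          where
          by-content : ∀ μ → φ p q ≡ μ → ∑[ x ∈ cells s Λ ] 𝟙 (attacking x (p , q) ∧ diagInv φ x (p , q))
                                          ≡ maybe′ inversionsOf 0 μ
          by-content nothing φpq≡∅ = ∑-zero {xs = cells s Λ} λ {x} _ →
            cong (λ b → 𝟙 (attacking x (p , q) ∧ b)) (diagInv-nothing φ {proj₁ x} {proj₂ x} φpq≡∅)
            ⟨ trans ⟩ cong 𝟙 (∧-zeroʳ (attacking x (p , q)))
          by-content (just c) φpq≡c =
            trans (∑-pairs (range1 s) (λ i → range1 (Λ i)) _)
                  (∑-cong {xs = range1 s} (attacks-in-row φpq≡c))

        dinv≡∑ : (∀ {c} → c ∈ range1 n → w c ∈ range1 N) → dinv s Λ φ ≡ ∑[ c ∈ range1 n ] inversionsOf c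
        dinv≡∑ w-into = begin
          dinv s Λ φ
            ≡⟨ count-pairs _ (cells s Λ) (λ _ → cells s Λ) ⟩
          ∑[ x ∈ cells s Λ ] ∑[ y ∈ cells s Λ ] 𝟙 (attacking x y ∧ diagInv φ x y)
            ≡⟨ ∑-swap (cells s Λ) (cells s Λ) _ ⟩
          ∑[ y ∈ cells s Λ ] ∑[ x ∈ cells s Λ ] 𝟙 (attacking x y ∧ diagInv φ x y)
            ≡⟨ ∑-cong {xs = cells s Λ} (λ {y} _ → attacks-on (proj₁ y) (proj₂ y)) ⟩
          ∑[ y ∈ cells s Λ ] maybe′ inversionsOf 0 (φ (proj₁ y) (proj₂ y))
            ≡⟨ ∑-cong {xs = cells s Λ} (λ y∈ → cong (maybe′ inversionsOf 0) (φ-cell y∈)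
                                          ⟨ trans ⟩ sym (∑-preimage n w w-injective inversionsOf _)) ⟩
          ∑[ y ∈ cells s Λ ] ∑[ c ∈ range1 n ] (𝟙 (w c ≡ᵇ rank y) * inversionsOf c)
            ≡⟨ ∑-swap (cells s Λ) (range1 n) _ ⟩
          ∑[ c ∈ range1 n ] ∑[ y ∈ cells s Λ ] (𝟙 (w c ≡ᵇ rank y) * inversionsOf c)
            ≡⟨ ∑-cong {xs = range1 n} (λ {c} c∈ → ∑-*ʳ (cells s Λ) _ (inversionsOf c)
                 ⟨ trans ⟩ cong (_* inversionsOf c) (rank-fibre (w-into c∈))
                 ⟨ trans ⟩ *-identityˡ (inversionsOf c)) ⟩
          ∑[ c ∈ range1 n ] inversionsOf c
            ∎
          where open ≡-Reasoning

-- Partitions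

length-cells : ∀ s Λ → length (cells s Λ) ≡ ∑[ a ∈ range1 s ] Λ a
length-cells s Λ =
  trans (length-pairs (range1 s) (λ a → range1 (Λ a)))
        (∑-cong {xs = range1 s} (λ {a} _ → length-range1 (Λ a)))

part-head : ∀ {x xs} → Linked (λ x y → y ≤ x) (x ∷ xs) → part xs 1 ≤ x
part-head [-]         = z≤n
part-head (y≤x ∷ _)   = y≤x

part-antitone : ∀ {lam} → Linked (λ x y → y ≤ x) lam → ∀ {i p} → 1 ≤ i → i ≤ p → part lam p ≤ part lam i
part-antitone {[]}     _ _ _ = z≤n
part-antitone {x ∷ xs} L {1}           {1}           _ _ = ≤-refl
part-antitone {x ∷ xs} L {1}           {suc (suc p)} _ _ =
  ≤-trans (part-antitone (tail L) {1} {suc p} (s≤s z≤n) (s≤s z≤n)) (part-head L)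
part-antitone {x ∷ xs} L {suc (suc i)} {suc (suc p)} _ (s≤s i≤p) = part-antitone (tail L) (s≤s z≤n) i≤p
part-antitone {x ∷ xs} L {suc (suc i)} {1}           _ (s≤s ())

∑-parts : ∀ lam s → length lam ≤ s → ∑[ a ∈ range1 s ] part lam a ≡ sum lam
∑-parts []       s _ = ∑-zero {xs = range1 s} (λ _ → refl)
∑-parts (x ∷ xs) (suc s) (s≤s ℓ≤s) = begin
  ∑[ a ∈ range1 (suc s) ] part (x ∷ xs) a      ≡⟨ ∑-range1-suc s (part (x ∷ xs)) ⟩
  x + ∑[ a ∈ range1 s ] part (x ∷ xs) (suc a)  ≡⟨ cong (x +_) (∑-cong {xs = range1 s} shift) ⟩
  x + ∑[ a ∈ range1 s ] part xs a              ≡⟨ cong (x +_) (∑-parts xs s ℓ≤s) ⟩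
  x + sum xs                                   ∎
  where
  open ≡-Reasoning
  shift : ∀ {a} → a ∈ range1 s → part (x ∷ xs) (suc a) ≡ part xs a
  shift a∈ with ∈-range1⁻ a∈
  ... | s≤s z≤n , _ = refl

length-cells-bigΛ : ∀ {lam} n k s → sum lam ≡ k → length lam ≤ s →
                    length (cells s (bigΛ lam n k)) ≡ k + (n ∸ k) * s
length-cells-bigΛ {lam} n k s sum≡k ℓ≤s = begin
  length (cells s (bigΛ lam n k))                   ≡⟨ length-cells s (bigΛ lam n k) ⟩
  ∑[ a ∈ range1 s ] (part lam a + (n ∸ k))          ≡⟨ ∑-+ (range1 s) (part lam) _ ⟩
  ∑[ a ∈ range1 s ] part lam a + ∑[ _ ∈ range1 s ] (n ∸ k)
                                                    ≡⟨ cong₂ _+_ (trans (∑-parts lam s ℓ≤s) sum≡k)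
                                                                 (∑-const (range1 s) (n ∸ k)) ⟩
  k + length (range1 s) * (n ∸ k)                   ≡⟨ cong (λ m → k + m * (n ∸ k)) (length-range1 s) ⟩
  k + s * (n ∸ k)                                   ≡⟨ cong (k +_) (*-comm s (n ∸ k)) ⟩
  k + (n ∸ k) * s                                   ∎
  where open ≡-Reasoning

bigΛ-antitone : ∀ {lam} n k → Linked (λ x y → y ≤ x) lam →
                ∀ {i p} → 1 ≤ i → i ≤ p → bigΛ lam n k p ≤ bigΛ lam n k i
bigΛ-antitone n k weakly-decreasing 1≤i i≤p = +-monoˡ-≤ (n ∸ k) (part-antitone weakly-decreasing 1≤i i≤p)

lemma3p6 : (n k s : ℕ) (lam : List ℕ) → IsPartition lam → sum lam ≡ k → k ≤ n →
    length lam ≤ s → (w : ℕ → ℕ) →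
    IsInjectiveMap n (k + (n ∸ k) * s) w →
    Admissible s (bigΛ lam n k) (readingT s (bigΛ lam n k)) n k w →
    inv s (bigΛ lam n k) (readingT s (bigΛ lam n k)) n w
      ≡ dinv s (bigΛ lam n k) (PRD s (bigΛ lam n k) (readingT s (bigΛ lam n k)) n w)
lemma3p6 n k s lam (_ , weakly-decreasing) sum≡k _ ℓ≤s w (w-bounds , w-inj) admissible =
  trans inv≡∑ (sym (dinv≡∑ (bigΛ-antitone {lam} n k weakly-decreasing) w-into))
  where
  open ReadingOrder s (bigΛ lam n k)

  w-into : ∀ {c} → c ∈ range1 n → w c ∈ range1 N
  w-into c∈ with ∈-range1⁻ c∈
  ... | 1≤c , c≤n with w-bounds _ 1≤c c≤n
  ...   | 1≤wc , wc≤K = ∈-range1⁺ 1≤wc (subst (_ ≤_) (sym (length-cells-bigΛ {lam} n k s sum≡k ℓ≤s)) wc≤K)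

  w-injective : InjectiveOn (range1 n) w
  w-injective c∈ c′∈ with ∈-range1⁻ c∈ | ∈-range1⁻ c′∈
  ... | 1≤c , c≤n | 1≤c′ , c′≤n = w-inj _ _ 1≤c c≤n 1≤c′ c′≤n

  open Filling n w w-injective
  open Rows (admissible⇒decreasing admissible)
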